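{- Let $\mathfrak M=(W,R,V)$ be a model rooted at $0$, $\Phi$ a $\sigma$-cover of $\mathfrak M$, and $\mathfrak A$ the $\Phi$-abstraction of $\mathfrak M$. Then for every frame $\mathfrak F'=(W',R')$ rooted at $0$ and every relation $Z\subseteq W\times W'$ the following are equivalent: (1) $Z:(\mathfrak M,0)\sim_\sigma(\mathfrak M',0)$ for some model $\mathfrak M'$ based on $\mathfrak F'$; (2) $Z:(\mathfrak A,0)\sim_\Phi(\mathfrak A',0)$ for some abstract $\Phi$-model $\mathfrak A'$ based on $\mathfrak F'$. Furthermore, if such $\mathfrak A'$ and $\mathfrak M'$ exist, then $\mathfrak A'$ is the $\Phi$-abstraction of $\mathfrak M'$.
   Context: A signature $\sigma$ is a finite set of atoms; $\mathrm{PL}(\sigma)$ = propositional formulas over $\sigma$. A frame/model is rooted at $0$ if every world is reachable from $0$. A $\sigma$-EME is a finite $\Phi\subseteq\mathrm{PL}(\sigma)$ with $\bigvee\Phi$ a tautology and its members pairwise inconsistent. $\Phi$ is a $\sigma$-cover of $\mathfrak M$ if any two worlds satisfying the same $\phi\in\Phi$ satisfy the same formulas of $\mathrm{PL}(\sigma)$. An abstract $\Phi$-model is a pair $(\mathfrak F,f)$ with $\mathfrak F=(W,R)$ a frame and $f:W\to\Phi$. If $\Phi$ is a $\sigma$-cover of $\mathfrak M$ (based on $\mathfrak F$), the $\Phi$-abstraction of $\mathfrak M$ is the unique $(\mathfrak F,f)$ with $\mathfrak M,w\models f(w)$ for all $w$. A $\sigma$-bisimulation between models $\mathfrak M_1,\mathfrak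 M_2$ is $Z\subseteq W_1\times W_2$ such that $w_1Zw_2$ implies agreement on all atoms of $\sigma$, plus Forth (if $w_1Zw_2$, $w_1R_1v_1$, there is $v_2$ with $w_2R_2v_2$, $v_1Zv_2$) and Back (symmetric). An abstract $\Phi$-bisimulation between abstract $\Phi$-models $(\mathfrak F_1,f_1),(\mathfrak F_2,f_2)$ is a relation satisfying Forth and Back and: $w_1Zw_2$ implies $f_1(w_1)=f_2(w_2)$. $Z:(\mathfrak M_1,w_1)\sim_\sigma(\mathfrak M_2,w_2)$ (resp. $Z:(\mathfrak A_1,w_1)\sim_\Phi(\mathfrak A_2,w_2)$) means $Z$ is a $\sigma$-bisimulation (resp. abstract $\Phi$-bisimulation) with $w_1Zw_2$. -}

module Defs where

open import Data.Nat using (ℕ)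
open import Data.Bool using (Bool; true; false; _∧_; _∨_; not)
open import Data.List using (List; []; _∷_; foldr)
open import Data.List.Membership.Propositional using (_∈_)
open import Data.Product using (Σ; _×_; _,_; ∃)
open import Relation.Binary.PropositionalEquality using (_≡_; _≢_)
open import Relation.Binary.Construct.Closure.ReflexiveTransitive using (Star)
open import Relation.Nullary using (¬_)

Atom : Set
Atom = ℕ

Signature : Set
Signature = List Atom

data Form : Set where
  var  : Atom → Form
  ⊥'   : Form
  ¬'_  : Form → Form
  _∧'_ : Form → Form → Form
  _∨'_ : Form → Form → Form
  _⇒'_ : Form → Form → Form

data InPL (σ : Signature) : Form → Set where
  var  : ∀ {p} → p ∈ σ → InPL σ (var p)
  ⊥'   : InPL σ ⊥'
  ¬'_  : ∀ {φ} → InPL σ φ → InPL σ (¬' φ)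
  _∧'_ : ∀ {φ ψ} → InPL σ φ → InPL σ ψ → InPL σ (φ ∧' ψ)
  _∨'_ : ∀ {φ ψ} → InPL σ φ → InPL σ ψ → InPL σ (φ ∨' ψ)
  _⇒'_ : ∀ {φ ψ} → InPL σ φ → InPL σ ψ → InPL σ (φ ⇒' ψ)

eval : (Atom → Bool) → Form → Bool
eval v (var p)   = v p
eval v ⊥'        = false
eval v (¬' φ)    = not (eval v φ)
eval v (φ ∧' ψ)  = eval v φ ∧ eval v ψ
eval v (φ ∨' ψ)  = eval v φ ∨ eval v ψ
eval v (φ ⇒' ψ)  = not (eval v φ) ∨ eval v ψ

Tautology : Form → Set
Tautology φ = ∀ (v : Atom → Bool) → eval v φ ≡ true

Consistent : Form → Set
Consistent φ = ∃ λ (v : Atom → Bool) → eval v φ ≡ true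

⋁ : List Form → Form
⋁ = foldr _∨'_ ⊥'

record IsEME (σ : Signature) (Φ : List Form) : Set where
  field
    inPL       : ∀ {φ} → φ ∈ Φ → InPL σ φ
    exhaustive : Tautology (⋁ Φ)
    exclusive  : ∀ {φ ψ} → φ ∈ Φ → ψ ∈ Φ → φ ≢ ψ → ¬ Consistent (φ ∧' ψ)

record Frame : Set₁ where
  field
    W : Set
    R : W → W → Set
open Frame public

RootedAt : (F : Frame) → W F → Set
RootedAt F r = ∀ (w : W F) → Star (R F) r w

record Model : Set₁ where
  constructor model
  field
    frame : Frame
    V     : W frame → Atom → Bool
open Model public

Wld : Model → Set
Wld 𝔐 = W (frame 𝔐)

Acc : (𝔐 : Model) → Wld 𝔐 → Wld 𝔐 → Set
Acc 𝔐 = R (frame 𝔐)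

_,_⊨_ : (𝔐 : Model) → Wld 𝔐 → Form → Set
𝔐 , w ⊨ φ = eval (V 𝔐 w) φ ≡ true

record IsCover (σ : Signature) (Φ : List Form) (𝔐 : Model) : Set where
  field
    eme   : IsEME σ Φ
    cover : ∀ {φ} (w₁ w₂ : Wld 𝔐) → φ ∈ Φ → 𝔐 , w₁ ⊨ φ → 𝔐 , w₂ ⊨ φ →
            ∀ ψ → InPL σ ψ → eval (V 𝔐 w₁) ψ ≡ eval (V 𝔐 w₂) ψ

-- An abstract Φ-model based on F is a map f : W → Φ (here: W → Form landing in Φ).
IsAbstractModel : (Φ : List Form) (F : Frame) → (W F → Form) → Set
IsAbstractModel Φ F f = ∀ (w : W F) → f w ∈ Φ

record IsAbstraction (σ : Signature) (Φ : List Form) (𝔐 : Model) (f : Wld 𝔐 → Form) : Set where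
  field
    isCover  : IsCover σ Φ 𝔐
    inΦ      : IsAbstractModel Φ (frame 𝔐) f
    sat      : ∀ (w : Wld 𝔐) → 𝔐 , w ⊨ f w

Forth : (F₁ F₂ : Frame) → (W F₁ → W F₂ → Set) → Set
Forth F₁ F₂ Z = ∀ {w₁ w₂ v₁} → Z w₁ w₂ → R F₁ w₁ v₁ →
                Σ (W F₂) λ v₂ → R F₂ w₂ v₂ × Z v₁ v₂

Back : (F₁ F₂ : Frame) → (W F₁ → W F₂ → Set) → Set
Back F₁ F₂ Z = ∀ {w₁ w₂ v₂} → Z w₁ w₂ → R F₂ w₂ v₂ →
               Σ (W F₁) λ v₁ → R F₁ w₁ v₁ × Z v₁ v₂

record IsσBisim (σ : Signature) (𝔐₁ 𝔐₂ : Model) (Z : Wld 𝔐₁ → Wld 𝔐₂ → Set) : Set where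
  field
    atoms : ∀ {w₁ w₂} → Z w₁ w₂ → ∀ {p} → p ∈ σ → V 𝔐₁ w₁ p ≡ V 𝔐₂ w₂ p
    forth : Forth (frame 𝔐₁) (frame 𝔐₂) Z
    back  : Back (frame 𝔐₁) (frame 𝔐₂) Z

record IsAbsBisim (F₁ : Frame) (f₁ : W F₁ → Form) (F₂ : Frame) (f₂ : W F₂ → Form)
                  (Z : W F₁ → W F₂ → Set) : Set where
  field
    label : ∀ {w₁ w₂} → Z w₁ w₂ → f₁ w₁ ≡ f₂ w₂
    forth : Forth F₁ F₂ Z
    back  : Back F₁ F₂ Z

σBisimAt : (σ : Signature) (𝔐₁ : Model) (w₁ : Wld 𝔐₁) (𝔐₂ : Model) (w₂ : Wld 𝔐₂)
           (Z : Wld 𝔐₁ → Wld 𝔐₂ → Set) → Set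
σBisimAt σ 𝔐₁ w₁ 𝔐₂ w₂ Z = IsσBisim σ 𝔐₁ 𝔐₂ Z × Z w₁ w₂

AbsBisimAt : (F₁ : Frame) (f₁ : W F₁ → Form) (w₁ : W F₁)
             (F₂ : Frame) (f₂ : W F₂ → Form) (w₂ : W F₂)
             (Z : W F₁ → W F₂ → Set) → Set
AbsBisimAt F₁ f₁ w₁ F₂ f₂ w₂ Z = IsAbsBisim F₁ f₁ F₂ f₂ Z × Z w₁ w₂

{-# OPTIONS --safe #-}
module Submission where

-- For the abstraction f of 𝔐, two worlds carry the same label iff they agree on σ:
-- exclusivity of Φ gives one direction, the cover property the other.  Since F' is
-- rooted and Z has Back, every world of F' is Z-related to some world of 𝔐, so the
-- missing valuation (resp. labelling) of F' can be copied from any Z-preimage, and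
-- this equivalence makes the copy independent of the preimage chosen.

open import Defs
open import Data.Bool using (Bool; true; _∧_; _∨_; not)
open import Data.Empty using (⊥-elim)
open import Data.List using (List)
open import Data.List.Membership.Propositional using (_∈_)
open import Data.Product using (Σ; ∃; _×_; _,_; proj₁)
open import Function.Bundles using (_⇔_; mk⇔)
import Data.Nat as ℕ
open import Relation.Binary.Construct.Closure.ReflexiveTransitive using (Star; ε; _◅_)
open import Relation.Binary.Definitions using (DecidableEquality)
open import Relation.Binary.PropositionalEquality
open import Relation.Nullary using (yes; no)

private
  variable
    σ : Signature
    Φ : List Form
    φ ψ : Form
    v u t : Atom → Bool

_≟_ : DecidableEquality Form
var p ≟ var q with p ℕ.≟ q
... | yes refl = yes refl
... | no p≢q   = no λ { refl → p≢q refl }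
var _ ≟ ⊥'       = no λ ()
var _ ≟ (¬' _)   = no λ ()
var _ ≟ (_ ∧' _) = no λ ()
var _ ≟ (_ ∨' _) = no λ ()
var _ ≟ (_ ⇒' _) = no λ ()
⊥' ≟ var _    = no λ ()
⊥' ≟ ⊥'       = yes refl
⊥' ≟ (¬' _)   = no λ ()
⊥' ≟ (_ ∧' _) = no λ ()
⊥' ≟ (_ ∨' _) = no λ ()
⊥' ≟ (_ ⇒' _) = no λ ()
(¬' _) ≟ var _ = no λ ()
(¬' _) ≟ ⊥'    = no λ ()
(¬' a) ≟ (¬' b) with a ≟ b
... | yes refl = yes refl
... | no a≢b   = no λ { refl → a≢b refl }
(¬' _) ≟ (_ ∧' _) = no λ ()
(¬' _) ≟ (_ ∨' _) = no λ ()
(¬' _) ≟ (_ ⇒' _) = no λ ()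
(_ ∧' _) ≟ var _  = no λ ()
(_ ∧' _) ≟ ⊥'     = no λ ()
(_ ∧' _) ≟ (¬' _) = no λ ()
(a ∧' b) ≟ (c ∧' d) with a ≟ c | b ≟ d
... | yes refl | yes refl = yes refl
... | no a≢c   | _        = no λ { refl → a≢c refl }
... | _        | no b≢d   = no λ { refl → b≢d refl }
(_ ∧' _) ≟ (_ ∨' _) = no λ ()
(_ ∧' _) ≟ (_ ⇒' _) = no λ ()
(_ ∨' _) ≟ var _    = no λ ()
(_ ∨' _) ≟ ⊥'       = no λ ()
(_ ∨' _) ≟ (¬' _)   = no λ ()
(_ ∨' _) ≟ (_ ∧' _) = no λ ()
(a ∨' b) ≟ (c ∨' d) with a ≟ c | b ≟ d
... | yes refl | yes refl = yes refl
... | no a≢c   | _        = no λ { refl → a≢c refl }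
... | _        | no b≢d   = no λ { refl → b≢d refl }
(_ ∨' _) ≟ (_ ⇒' _) = no λ ()
(_ ⇒' _) ≟ var _    = no λ ()
(_ ⇒' _) ≟ ⊥'       = no λ ()
(_ ⇒' _) ≟ (¬' _)   = no λ ()
(_ ⇒' _) ≟ (_ ∧' _) = no λ ()
(_ ⇒' _) ≟ (_ ∨' _) = no λ ()
(a ⇒' b) ≟ (c ⇒' d) with a ≟ c | b ≟ d
... | yes refl | yes refl = yes refl
... | no a≢c   | _        = no λ { refl → a≢c refl }
... | _        | no b≢d   = no λ { refl → b≢d refl }

Agree : Signature → (Atom → Bool) → (Atom → Bool) → Set
Agree σ v u = ∀ {p} → p ∈ σ → v p ≡ u p

agree-sym : Agree σ v u → Agree σ u v
agree-sym v≈u p∈σ = sym (v≈u p∈σ)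

agree-trans : Agree σ v u → Agree σ u t → Agree σ v t
agree-trans v≈u u≈t p∈σ = trans (v≈u p∈σ) (u≈t p∈σ)

eval-agree : Agree σ v u → InPL σ ψ → eval v ψ ≡ eval u ψ
eval-agree v≈u (var p∈σ) = v≈u p∈σ
eval-agree v≈u ⊥'       = refl
eval-agree v≈u (¬' a)   = cong not (eval-agree v≈u a)
eval-agree v≈u (a ∧' b) = cong₂ _∧_ (eval-agree v≈u a) (eval-agree v≈u b)
eval-agree v≈u (a ∨' b) = cong₂ _∨_ (eval-agree v≈u a) (eval-agree v≈u b)
eval-agree v≈u (a ⇒' b) = cong₂ (λ x y → not x ∨ y) (eval-agree v≈u a) (eval-agree v≈u b)

satisfied-member-unique : IsEME σ Φ → φ ∈ Φ → ψ ∈ Φ →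
                          eval v φ ≡ true → eval v ψ ≡ true → φ ≡ ψ
satisfied-member-unique {φ = φ} {ψ} {v} eme φ∈Φ ψ∈Φ vφ vψ with φ ≟ ψ
... | yes φ≡ψ = φ≡ψ
... | no φ≢ψ  = ⊥-elim (IsEME.exclusive eme φ∈Φ ψ∈Φ φ≢ψ (v , cong₂ _∧_ vφ vψ))

module _ {𝔐 : Model} {f : Wld 𝔐 → Form} (abs : IsAbstraction σ Φ 𝔐 f) where
  open IsAbstraction abs
  open IsCover isCover
  open IsEME eme

  abstraction-agree⇒≡ : ∀ {w u} → Agree σ (V 𝔐 w) (V 𝔐 u) → f w ≡ f u
  abstraction-agree⇒≡ {w} {u} w≈u =
    satisfied-member-unique eme (inΦ w) (inΦ u)
      (trans (sym (eval-agree w≈u (inPL (inΦ w)))) (sat w)) (sat u)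

  abstraction-≡⇒agree : ∀ {w u} → f w ≡ f u → Agree σ (V 𝔐 w) (V 𝔐 u)
  abstraction-≡⇒agree {w} {u} fw≡fu {p} p∈σ =
    cover w u (inΦ w) (sat w) (subst (𝔐 , u ⊨_) (sym fw≡fu) (sat u)) (var p) (var p∈σ)

cover-transfer : {𝔐 𝔐' : Model} → IsCover σ Φ 𝔐 →
                 (∀ w' → ∃ λ w → Agree σ (V 𝔐 w) (V 𝔐' w')) → IsCover σ Φ 𝔐'
cover-transfer {σ} {Φ} {𝔐} {𝔐'} cov agreeing = record { eme = eme ; cover = cover' }
  where
  open IsCover cov
  open IsEME eme

  cover' : ∀ {φ} (w₁' w₂' : Wld 𝔐') → φ ∈ Φ → 𝔐' , w₁' ⊨ φ → 𝔐' , w₂' ⊨ φ →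
           ∀ ψ → InPL σ ψ → eval (V 𝔐' w₁') ψ ≡ eval (V 𝔐' w₂') ψ
  cover' w₁' w₂' φ∈Φ w₁'⊨φ w₂'⊨φ ψ ψ∈PL with agreeing w₁' | agreeing w₂'
  ... | w₁ , w₁≈w₁' | w₂ , w₂≈w₂' = begin
    eval (V 𝔐' w₁') ψ ≡⟨ eval-agree (agree-sym w₁≈w₁') ψ∈PL ⟩
    eval (V 𝔐 w₁) ψ   ≡⟨ cover w₁ w₂ φ∈Φ (trans (eval-agree w₁≈w₁' (inPL φ∈Φ)) w₁'⊨φ)
                                          (trans (eval-agree w₂≈w₂' (inPL φ∈Φ)) w₂'⊨φ) ψ ψ∈PL ⟩
    eval (V 𝔐 w₂) ψ   ≡⟨ eval-agree w₂≈w₂' ψ∈PL ⟩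
    eval (V 𝔐' w₂') ψ ∎
    where open ≡-Reasoning

abstraction-transfer : {𝔐 𝔐' : Model} {f : Wld 𝔐 → Form} {f' : Wld 𝔐' → Form} →
                       IsAbstraction σ Φ 𝔐 f → IsAbstractModel Φ (frame 𝔐') f' →
                       (∀ w' → ∃ λ w → Agree σ (V 𝔐 w) (V 𝔐' w') × f w ≡ f' w') →
                       IsAbstraction σ Φ 𝔐' f'
abstraction-transfer {𝔐' = 𝔐'} {f' = f'} abs f'∈Φ matching = record
  { isCover = cover-transfer isCover (λ w' → let w , w≈w' , _ = matching w' in w , w≈w')
  ; inΦ     = f'∈Φ
  ; sat     = sat'
  }
  where
  open IsAbstraction abs
  open IsEME (IsCover.eme isCover)

  sat' : ∀ w' → 𝔐' , w' ⊨ f' w'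
  sat' w' with matching w'
  ... | w , w≈w' , fw≡f'w' = subst (𝔐' , w' ⊨_) fw≡f'w'
                                 (trans (sym (eval-agree w≈w' (inPL (inΦ w)))) (sat w))

module _ {𝔐 : Model} {f : Wld 𝔐 → Form} {F' : Frame} {Z : Wld 𝔐 → W F' → Set}
         (abs : IsAbstraction σ Φ 𝔐 f) (preimage : ∀ w' → ∃ λ w → Z w w') where

  σ-bisim⇒abs-bisim : {V' : W F' → Atom → Bool} → IsσBisim σ 𝔐 (model F' V') Z →
                      IsAbsBisim (frame 𝔐) f F' (λ w' → f (proj₁ (preimage w'))) Z
  σ-bisim⇒abs-bisim bisim = record { label = label ; forth = forth ; back = back }
    where
    open IsσBisim bisim
    label : ∀ {w w'} → Z w w' → f w ≡ f (proj₁ (preimage w'))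
    label {w' = w'} wZw' = let _ , uZw' = preimage w' in
      abstraction-agree⇒≡ abs (agree-trans (atoms wZw') (agree-sym (atoms uZw')))

  abs-bisim⇒σ-bisim : {f' : W F' → Form} → IsAbsBisim (frame 𝔐) f F' f' Z →
                      IsσBisim σ 𝔐 (model F' (λ w' → V 𝔐 (proj₁ (preimage w')))) Z
  abs-bisim⇒σ-bisim bisim = record { atoms = atoms ; forth = forth ; back = back }
    where
    open IsAbsBisim bisim
    atoms : ∀ {w w'} → Z w w' → Agree σ (V 𝔐 w) (V 𝔐 (proj₁ (preimage w')))
    atoms {w' = w'} wZw' = let _ , uZw' = preimage w' in
      abstraction-≡⇒agree abs (trans (label wZw') (sym (label uZw')))

Back-reachable-related : {F₁ F₂ : Frame} {Z : W F₁ → W F₂ → Set} → Back F₁ F₂ Z →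
                         ∀ {w₁ w₂ v₂} → Z w₁ w₂ → Star (R F₂) w₂ v₂ → ∃ λ v₁ → Z v₁ v₂
Back-reachable-related back {w₁} w₁Zw₂ ε = w₁ , w₁Zw₂
Back-reachable-related back w₁Zw₂ (w₂Rv₂ ◅ path) =
  let v₁ , _ , v₁Zv₂ = back w₁Zw₂ w₂Rv₂ in Back-reachable-related back v₁Zv₂ path

proposition4p3 : (σ : Signature) (Φ : List Form) (𝔐 : Model) (r : Wld 𝔐) →
    RootedAt (frame 𝔐) r →
    IsCover σ Φ 𝔐 →
    (f : Wld 𝔐 → Form) → IsAbstraction σ Φ 𝔐 f →
    (F' : Frame) (r' : W F') → RootedAt F' r' →
    (Z : Wld 𝔐 → W F' → Set) →
      ((Σ (W F' → Atom → Bool) λ V' → σBisimAt σ 𝔐 r (model F' V') r' Z)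
        ⇔
       (Σ (W F' → Form) λ f' → IsAbstractModel Φ F' f' × AbsBisimAt (frame 𝔐) f r F' f' r' Z))
      ×
      (∀ (V' : W F' → Atom → Bool) (f' : W F' → Form) →
         σBisimAt σ 𝔐 r (model F' V') r' Z →
         IsAbstractModel Φ F' f' → AbsBisimAt (frame 𝔐) f r F' f' r' Z →
         IsAbstraction σ Φ (model F' V') f')
proposition4p3 σ Φ 𝔐 r _ _ f abs F' r' rooted' Z =
  mk⇔ (λ (V' , bisim , rZr') →
         _ , (λ _ → IsAbstraction.inΦ abs _) ,
         σ-bisim⇒abs-bisim abs (preimage (IsσBisim.back bisim) rZr') bisim , rZr')
      (λ (f' , _ , bisim , rZr') →
         _ , abs-bisim⇒σ-bisim abs (preimage (IsAbsBisim.back bisim) rZr') bisim , rZr')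
  , λ V' f' (σ-bisim , _) f'∈Φ (Φ-bisim , rZr') →
      abstraction-transfer abs f'∈Φ λ w' →
        let w , wZw' = preimage (IsAbsBisim.back Φ-bisim) rZr' w' in
        w , IsσBisim.atoms σ-bisim wZw' , IsAbsBisim.label Φ-bisim wZw'
  where
  preimage : Back (frame 𝔐) F' Z → Z r r' → ∀ w' → ∃ λ w → Z w w'
  preimage back rZr' w' = Back-reachable-related back rZr' (rooted' w')
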